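{- For every preposet $p$ of $I$, the braid cone $\hat{\mathtt{C}}_p$ is the characteristic function of the closed conical space $\sigma_p$.
   Context: Let $\mathbb{k}$ be a field of characteristic zero and $I$ a finite set. Let $\mathrm{T}^I=\mathbb{R}^I/\mathbb{R}\lambda_I$ (functions $I\to\mathbb{R}$ modulo constants), where $\lambda_S\in\mathbb{R}^I$ is the indicator function of $S\subseteq I$. For a two-lump composition $(S,T)$ of $I$ ($S\sqcup T=I$, $S,T\ne\emptyset$) the fundamental weight $\lambda_{ST}$ is the image of $\lambda_S$ in $\mathrm{T}^I$. For distinct $i_1,i_2\in I$ the coroot $h_{i_1i_2}$ acts by $\langle h_{i_1i_2},\lambda\rangle=\lambda(i_1)-\lambda(i_2)$, and the halfspace $\hat{\mathtt{C}}_{i_1i_2}:\mathrm{T}^I\to\mathbb{k}$ is $1$ where $\langle h_{i_1i_2},\lambda\rangle\ge0$ and $0$ otherwise. A preposet $p$ of $I$ (reflexive transitive relation) is identified with its set of pairs $(i_1,i_2)$, $i_1\ne i_2$, with $i_1\ge_p i_2$; the braid cone is $\hat{\mathtt{C}}_p=\prod_{(i_1,i_2)\in p}\hat{\mathtt{C}}_{i_1i_2}$. A two-lump composition $(S,T)$ satisfies $(S,T)\le p$ if $S$ is an upward closed and $T$ a downward closed subset for $p$. Then $\sigma_p\subseteq\mathrm{T}^I$ is the set of non-negative real linear combinations of $\{\lambda_{ST}:(S,T)\le p\}$. -}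

module Defs where

open import Level using (0ℓ)
open import Data.Bool using (Bool; true; false; if_then_else_; not; _∧_)
open import Data.Nat using (ℕ; zero; suc)
open import Data.Fin using (Fin)
open import Data.Fin.Properties using () renaming (_≟_ to _≟ᶠ_)
open import Data.List using (List; []; _∷_; map; foldr; concatMap; allFin)
open import Data.List.Relation.Unary.All using (All)
open import Data.Product using (Σ; ∃; ∃-syntax; _×_; _,_)
open import Relation.Nullary using (¬_; Dec; does)
open import Relation.Binary using (IsTotalOrder; Decidable)
open import Relation.Binary.PropositionalEquality using (_≡_)
open import Algebra.Bundles using (CommutativeRing)
open import Algebra.Structures using (IsCommutativeRing)

-- The real numbers, axiomatised as a complete ordered field
-- (unique up to isomorphism, so quantifying over all models is
-- the same as talking about ℝ).

record RealField : Set₁ where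
  infixl 6 _+_ _-_
  infixl 7 _*_
  infix 4 _≤_
  field
    ℝ    : Set
    _+_  : ℝ → ℝ → ℝ
    _*_  : ℝ → ℝ → ℝ
    -_   : ℝ → ℝ
    0ℝ   : ℝ
    1ℝ   : ℝ
    _≤_  : ℝ → ℝ → Set
    isCommutativeRing : IsCommutativeRing _≡_ _+_ _*_ -_ 0ℝ 1ℝ
    0≢1  : ¬ (0ℝ ≡ 1ℝ)
    inverse : ∀ x → ¬ (x ≡ 0ℝ) → ∃[ y ] (x * y ≡ 1ℝ)
    isTotalOrder : IsTotalOrder _≡_ _≤_
    _≤?_ : Decidable _≤_
    +-mono-≤ : ∀ {x y} z → x ≤ y → x + z ≤ y + z
    *-nonneg : ∀ {x y} → 0ℝ ≤ x → 0ℝ ≤ y → 0ℝ ≤ x * y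
    complete : (P : ℝ → Set) → ∃[ x ] P x → ∃[ b ] (∀ x → P x → x ≤ b) →
               ∃[ s ] ((∀ x → P x → x ≤ s) ×
                       (∀ b → (∀ x → P x → x ≤ b) → s ≤ b))

  _-_ : ℝ → ℝ → ℝ
  x - y = x + (- y)

natCast : (R : CommutativeRing 0ℓ 0ℓ) → ℕ → CommutativeRing.Carrier R
natCast R zero    = CommutativeRing.0# R
natCast R (suc m) = CommutativeRing._+_ R (CommutativeRing.1# R) (natCast R m)

record CharZeroField : Set₁ where
  field
    cring : CommutativeRing 0ℓ 0ℓ
  open CommutativeRing cring public
  field
    0≉1      : ¬ (0# ≈ 1#)
    inverse  : ∀ x → ¬ (x ≈ 0#) → ∃[ y ] (x * y ≈ 1#)
    charZero : ∀ (m : ℕ) → ¬ (natCast cring (suc m) ≈ 0#)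

module Braid (Rf : RealField) (K : CharZeroField) {n : ℕ} where
  open RealField Rf
  open CharZeroField K using (Carrier; 0#; 1#; _≈_) renaming (_*_ to _*ₖ_)

  -- Representatives of elements of T^I = ℝ^I / ℝ λ_I.
  Vect : Set
  Vect = Fin n → ℝ

  _∼_ : Vect → Vect → Set
  v ∼ w = ∃[ a ] (∀ i → v i ≡ a + w i)

  -- A preposet on I: a reflexive transitive relation, given by its
  -- (finite, hence decidable) characteristic function;
  -- ge i₁ i₂ ≡ true means i₁ ≥_p i₂.
  record Preposet : Set where
    field
      ge    : Fin n → Fin n → Bool
      refl  : ∀ i → ge i i ≡ true
      trans : ∀ i j k → ge i j ≡ true → ge j k ≡ true → ge i k ≡ true
  open Preposet public

  pairing : Fin n → Fin n → Vect → ℝ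
  pairing i₁ i₂ v = v i₁ - v i₂

  halfspace : Fin n → Fin n → Vect → Carrier
  halfspace i₁ i₂ v = if does (0ℝ ≤? pairing i₁ i₂ v) then 1# else 0#

  prodK : List Carrier → Carrier
  prodK = foldr _*ₖ_ 1#

  pairsOf : Preposet → List (Fin n × Fin n)
  pairsOf p = concatMap (λ i₁ → concatMap (λ i₂ →
      if ge p i₁ i₂ ∧ not (does (i₁ ≟ᶠ i₂)) then (i₁ , i₂) ∷ [] else [])
      (allFin n)) (allFin n)

  braidCone : Preposet → Vect → Carrier
  braidCone p v = prodK (map (λ { (i₁ , i₂) → halfspace i₁ i₂ v }) (pairsOf p))

  Subset : Set
  Subset = Fin n → Bool

  -- the two-lump composition (S, T) with T = I ∖ S, both nonempty
  TwoLump : Subset → Set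
  TwoLump S = (∃[ i ] S i ≡ true) × (∃[ i ] S i ≡ false)

  UpClosed : Preposet → Subset → Set
  UpClosed p S = ∀ i j → S i ≡ true → ge p j i ≡ true → S j ≡ true

  DownClosed : Preposet → Subset → Set
  DownClosed p T = ∀ i j → T i ≡ true → ge p i j ≡ true → T j ≡ true

  LumpLE : Subset → Preposet → Set
  LumpLE S p = UpClosed p S × DownClosed p (λ i → not (S i))

  -- λ_S (representative of the fundamental weight λ_{ST})
  indicator : Subset → Vect
  indicator S i = if S i then 1ℝ else 0ℝ

  sumV : List Vect → Vect
  sumV []       i = 0ℝ
  sumV (v ∷ vs) i = v i + sumV vs i

  InSigma : Preposet → Vect → Set
  InSigma p v = Σ (List (Subset × ℝ)) λ cs → (All (λ { (S , c) → TwoLump S × LumpLE S p × (0ℝ ≤ c) }) cs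
                 × (v ∼ sumV (map (λ { (S , c) → λ i → c * indicator S i }) cs)))

  IsCharFun : (Vect → Carrier) → (Vect → Set) → Set
  IsCharFun f P = ∀ v → (P v → f v ≈ 1#) × (¬ P v → f v ≈ 0#)

module Submission where

-- Both sides are compared with the set of p-monotone vectors, i.e. the
-- λ with  i ≥_p j ⇒ λ(j) ≤ λ(i)  (the closed braid cone of p):
--
--  * Ĉ_p(λ) is a product of halfspace values, one per pair of pairsOf p.
--    Every factor is 1 exactly when λ is p-monotone, and otherwise some
--    factor is 0; so Ĉ_p(λ) ≈ 1 on monotone λ and ≈ 0 off them.
--  * σ_p ⊆ monotone: a non-negative multiple of λ_S with S up-closed is
--    monotone, and monotone vectors are closed under sums and under
--    adding constants (so the property is well defined on T^I).
--  * monotone ⊆ σ_p ("layer cake"): list the values of λ in increasing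
--    order t₀ ≤ t₁ ≤ …; then λ = t₀ + Σ (tₖ − tₖ₋₁) λ_{S_{tₖ}} with the
--    superlevel sets S_t = {j | t ≤ λ(j)}, which are upward closed with
--    downward closed complement when λ is monotone. Repeated values are
--    skipped, so that every S_t used is a proper nonempty subset.

open import Defs
open import Level using (0ℓ)
open import Function using (_∘_)
open import Data.Nat using (ℕ)
open import Data.Bool using (true; false; if_then_else_; not; _∧_)
open import Data.Bool.Properties using (not-injective)
open import Data.Fin using (Fin)
open import Data.Fin.Properties using () renaming (_≟_ to _≟ᶠ_)
open import Data.List using (List; []; _∷_; map; foldr; concatMap; allFin)
open import Data.List.Relation.Unary.All as All using (All; []; _∷_)
import Data.List.Relation.Unary.All.Properties as AllP
open import Data.List.Relation.Unary.Any as Any using (Any; here; there)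
open import Data.List.Relation.Unary.Linked using (Linked; _∷_)
open import Data.List.Relation.Unary.Linked.Properties using (Linked⇒All)
open import Data.List.Membership.Propositional using (_∈_)
open import Data.List.Membership.Propositional.Properties using (∈-allFin; ∈-map⁺; ∈-concat⁺′)
open import Data.List.Relation.Binary.Permutation.Propositional using (↭-sym)
open import Data.List.Relation.Binary.Permutation.Propositional.Properties using (All-resp-↭; ∈-resp-↭)
import Data.List.Sort as Sorting
open import Data.Product using (∃-syntax; _×_; _,_; proj₁; proj₂)
open import Data.Sum using (inj₁; inj₂)
open import Relation.Nullary using (¬_; Dec; yes; no; does; contradiction)
open import Relation.Nullary.Decidable using (dec-true; dec-false)
open import Relation.Binary using (IsTotalOrder; DecTotalOrder; DecidableEquality)
open import Relation.Binary.PropositionalEquality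
  using (_≡_; refl; sym; trans; cong; cong₂; subst₂; module ≡-Reasoning)
open import Algebra.Bundles using (CommutativeRing)
open import Algebra.Structures using (IsCommutativeRing)

does-true : ∀ {a} {P : Set a} (d : Dec P) → does d ≡ true → P
does-true (yes p) _ = p

does-false : ∀ {a} {P : Set a} (d : Dec P) → does d ≡ false → ¬ P
does-false (no ¬p) _ = ¬p

module OrderedFieldFacts (Rf : RealField) where
  open RealField Rf
  open IsCommutativeRing isCommutativeRing
    using (+-assoc; +-comm; +-identityˡ; +-identityʳ; -‿inverseˡ; -‿inverseʳ)
  open IsTotalOrder isTotalOrder
    using (antisym; total) renaming (refl to ≤-refl; trans to ≤-trans)

  +-mono-≤₂ : ∀ {a b c d} → a ≤ b → c ≤ d → a + c ≤ b + d
  +-mono-≤₂ {a} {b} {c} {d} a≤b c≤d =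
    ≤-trans (+-mono-≤ c a≤b) (subst₂ _≤_ (+-comm c b) (+-comm d b) (+-mono-≤ b c≤d))

  sub-add : ∀ a b → (a - b) + b ≡ a
  sub-add a b = trans (+-assoc a (- b) b) (trans (cong (a +_) (-‿inverseˡ b)) (+-identityʳ a))

  add-sub : ∀ a b → b + (a - b) ≡ a
  add-sub a b = trans (+-comm b (a - b)) (sub-add a b)

  ≤⇒sub-nonneg : ∀ {a b} → b ≤ a → 0ℝ ≤ a - b
  ≤⇒sub-nonneg {a} {b} b≤a = subst₂ _≤_ (-‿inverseʳ b) refl (+-mono-≤ (- b) b≤a)

  sub-nonneg⇒≤ : ∀ {a b} → 0ℝ ≤ a - b → b ≤ a
  sub-nonneg⇒≤ {a} {b} h = subst₂ _≤_ (+-identityˡ b) (sub-add a b) (+-mono-≤ b h)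

  ≰⇒≥ : ∀ {a b} → ¬ a ≤ b → b ≤ a
  ≰⇒≥ {a} {b} a≰b with total a b
  ... | inj₁ a≤b = contradiction a≤b a≰b
  ... | inj₂ b≤a = b≤a

  _≟_ : DecidableEquality ℝ
  a ≟ b with a ≤? b | b ≤? a
  ... | yes a≤b | yes b≤a = yes (antisym a≤b b≤a)
  ... | no a≰b  | _       = no λ { refl → a≰b ≤-refl }
  ... | yes _   | no b≰a  = no λ { refl → b≰a ≤-refl }

  decTotalOrder : DecTotalOrder 0ℓ 0ℓ 0ℓ
  decTotalOrder = record
    { isDecTotalOrder = record { isTotalOrder = isTotalOrder ; _≟_ = _≟_ ; _≤?_ = _≤?_ } }

module ListProduct {c ℓ} (R : CommutativeRing c ℓ) where
  open CommutativeRing R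
    using (Carrier; _≈_; _*_; 0#; 1#; *-cong; *-identityˡ; zeroˡ; zeroʳ)
    renaming (refl to ≈-refl; trans to ≈-trans)

  product-ones : ∀ {a} {A : Set a} (f : A → Carrier) xs →
                 All (λ x → f x ≈ 1#) xs → foldr _*_ 1# (map f xs) ≈ 1#
  product-ones f [] [] = ≈-refl
  product-ones f (x ∷ xs) (fx≈1 ∷ rest) =
    ≈-trans (*-cong fx≈1 (product-ones f xs rest)) (*-identityˡ 1#)

  product-zero : ∀ {a} {A : Set a} (f : A → Carrier) xs →
                 Any (λ x → f x ≈ 0#) xs → foldr _*_ 1# (map f xs) ≈ 0#
  product-zero f (x ∷ xs) (here fx≈0) = ≈-trans (*-cong fx≈0 ≈-refl) (zeroˡ _)
  product-zero f (x ∷ xs) (there rest) = ≈-trans (*-cong ≈-refl (product-zero f xs rest)) (zeroʳ _)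

module BraidConeProof (Rf : RealField) (K : CharZeroField) {n : ℕ} where
  open RealField Rf
  open IsCommutativeRing isCommutativeRing using (+-assoc; +-identityʳ; *-identityʳ; zeroʳ)
  open IsTotalOrder isTotalOrder
    using (antisym) renaming (refl to ≤-refl; reflexive to ≤-reflexive; trans to ≤-trans)
  open OrderedFieldFacts Rf
  open Sorting decTotalOrder using (sort; sort-↗; sort-↭)
  open Braid Rf K {n} hiding (refl; trans)
  open CharZeroField K using (Carrier; _≈_; 0#; 1#; cring) renaming (refl to ≈-refl)
  open ListProduct cring

  Monotone : Preposet → Vect → Set
  Monotone p v = ∀ i j → ge p i j ≡ true → v j ≤ v i

  halfspaceAt : Vect → Fin n × Fin n → Carrier
  halfspaceAt v (i , j) = halfspace i j v

  candidate : Preposet → Fin n → Fin n → List (Fin n × Fin n)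
  candidate p i j = if ge p i j ∧ not (does (i ≟ᶠ j)) then (i , j) ∷ [] else []

  pairsOf-sound : ∀ p → All (λ x → ge p (proj₁ x) (proj₂ x) ≡ true) (pairsOf p)
  pairsOf-sound p =
    AllP.concat⁺ (AllP.map⁺ (All.universal (λ i →
      AllP.concat⁺ (AllP.map⁺ (All.universal (candidate-sound i) (allFin n)))) (allFin n)))
    where
    candidate-sound : ∀ i j → All (λ x → ge p (proj₁ x) (proj₂ x) ≡ true) (candidate p i j)
    candidate-sound i j with ge p i j in i≥j | i ≟ᶠ j
    ... | false | _     = []
    ... | true  | yes _ = []
    ... | true  | no _  = i≥j ∷ []

  pairsOf-complete : ∀ p {i j} → ge p i j ≡ true → ¬ i ≡ j → (i , j) ∈ pairsOf p
  pairsOf-complete p {i} {j} i≥j i≢j =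
    ∈-concat⁺′ (∈-concat⁺′ in-candidate (∈-map⁺ (candidate p i) (∈-allFin j)))
               (∈-map⁺ (λ i′ → concatMap (candidate p i′) (allFin n)) (∈-allFin i))
    where
    in-candidate : (i , j) ∈ candidate p i j
    in-candidate rewrite i≥j | dec-false (i ≟ᶠ j) i≢j = here refl

  NonNeg : Vect → Fin n × Fin n → Set
  NonNeg v x = 0ℝ ≤ pairing (proj₁ x) (proj₂ x) v

  halfspace-nonneg : ∀ {v} x → NonNeg v x → halfspaceAt v x ≈ 1#
  halfspace-nonneg {v} (i , j) h with 0ℝ ≤? pairing i j v
  ... | yes _ = ≈-refl
  ... | no ¬h = contradiction h ¬h

  halfspace-neg : ∀ {v} x → ¬ NonNeg v x → halfspaceAt v x ≈ 0#
  halfspace-neg {v} (i , j) ¬h with 0ℝ ≤? pairing i j v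
  ... | yes h = contradiction h ¬h
  ... | no _  = ≈-refl

  monotone⇒nonneg : ∀ {p v} → Monotone p v → All (NonNeg v) (pairsOf p)
  monotone⇒nonneg {p} mono = All.map (λ {x} g → ≤⇒sub-nonneg (mono (proj₁ x) (proj₂ x) g)) (pairsOf-sound p)

  nonneg⇒monotone : ∀ {p v} → All (NonNeg v) (pairsOf p) → Monotone p v
  nonneg⇒monotone {p} all-nonneg i j i≥j with i ≟ᶠ j
  ... | yes refl = ≤-refl
  ... | no i≢j   = sub-nonneg⇒≤ (All.lookup all-nonneg (pairsOf-complete p i≥j i≢j))

  braidCone-monotone : ∀ {p v} → Monotone p v → braidCone p v ≈ 1#
  braidCone-monotone {p} {v} mono =
    product-ones (halfspaceAt v) (pairsOf p) (All.map (halfspace-nonneg {v} _) (monotone⇒nonneg {p} {v} mono))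

  braidCone-not-monotone : ∀ {p v} → ¬ Monotone p v → braidCone p v ≈ 0#
  braidCone-not-monotone {p} {v} ¬mono =
    product-zero (halfspaceAt v) (pairsOf p) (Any.map (halfspace-neg {v} _) some-negative)
    where
    some-negative : Any (λ x → ¬ NonNeg v x) (pairsOf p)
    some-negative = AllP.¬All⇒Any¬ (λ x → 0ℝ ≤? pairing (proj₁ x) (proj₂ x) v) (pairsOf p)
                      (¬mono ∘ nonneg⇒monotone {p} {v})

  term : Subset × ℝ → Vect
  term (S , c) i = c * indicator S i

  Admissible : Preposet → Subset × ℝ → Set
  Admissible p (S , c) = TwoLump S × LumpLE S p × (0ℝ ≤ c)

  term-monotone : ∀ {p S c} → UpClosed p S → 0ℝ ≤ c → Monotone p (term (S , c))
  term-monotone {p} {S} {c} up c≥0 i j i≥j with S i in i∈S | S j in j∈S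
  ... | true  | true  = ≤-refl
  ... | true  | false = subst₂ _≤_ (sym (zeroʳ c)) (sym (*-identityʳ c)) c≥0
  ... | false | false = ≤-refl
  ... | false | true  = contradiction (trans (sym (up j i j∈S i≥j)) i∈S) λ ()

  sumV-monotone : ∀ {p vs} → All (Monotone p) vs → Monotone p (sumV vs)
  sumV-monotone [] i j i≥j = ≤-refl
  sumV-monotone {p} (mono ∷ monos) i j i≥j = +-mono-≤₂ (mono i j i≥j) (sumV-monotone {p} monos i j i≥j)

  ∼-monotone : ∀ {p v w} → v ∼ w → Monotone p w → Monotone p v
  ∼-monotone (a , v≡a+w) mono i j i≥j =
    subst₂ _≤_ (sym (v≡a+w j)) (sym (v≡a+w i)) (+-mono-≤₂ ≤-refl (mono i j i≥j))

  σ⊆monotone : ∀ {p v} → InSigma p v → Monotone p v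
  σ⊆monotone {p} (cs , admissible , v∼) =
    ∼-monotone {p} v∼ (sumV-monotone {p} (AllP.map⁺ (All.map term-admissible admissible)))
    where
    term-admissible : ∀ {x} → Admissible p x → Monotone p (term x)
    term-admissible (_ , (up , _) , c≥0) = term-monotone {p} up c≥0

  module LayerCake (v : Vect) where

    above : ℝ → Subset
    above t j = does (t ≤? v j)

    layers : ℝ → List ℝ → List (Subset × ℝ)
    layers prev [] = []
    layers prev (t ∷ ts) with t ≤? prev
    ... | yes _ = layers prev ts
    ... | no _  = (above t , t - prev) ∷ layers t ts

    layers-vanish : ∀ {j} prev ts → All (λ t → ¬ t ≤ v j) ts → sumV (map term (layers prev ts)) j ≡ 0ℝ
    layers-vanish prev [] [] = refl
    layers-vanish {j} prev (t ∷ ts) (t≰vj ∷ rest) with t ≤? prev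
    ... | yes _ = layers-vanish prev ts rest
    ... | no _ with t ≤? v j
    ...   | yes t≤vj = contradiction t≤vj t≰vj
    ...   | no _     = trans (cong₂ _+_ (zeroʳ (t - prev)) (layers-vanish t ts rest)) (+-identityʳ 0ℝ)

    layer-cake : ∀ {j} prev ts → Linked _≤_ (prev ∷ ts) → v j ∈ prev ∷ ts →
                 v j ≡ prev + sumV (map term (layers prev ts)) j
    layer-cake prev [] _ (here vj≡prev) = trans vj≡prev (sym (+-identityʳ prev))
    layer-cake {j} prev (t ∷ ts) (prev≤t ∷ sorted) vj∈ with t ≤? prev
    ... | yes t≤prev with antisym t≤prev prev≤t
    ...   | refl = layer-cake _ ts sorted (drop-repeat vj∈)
      where
      drop-repeat : v j ∈ t ∷ t ∷ ts → v j ∈ t ∷ ts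
      drop-repeat (here e) = here e
      drop-repeat (there m) = m
    layer-cake {j} prev (t ∷ ts) (prev≤t ∷ sorted) vj∈ | no t≰prev with t ≤? v j
    ... | yes t≤vj = begin
          v j                                 ≡⟨ layer-cake t ts sorted (skip-prev vj∈) ⟩
          t + rest                            ≡⟨ cong (_+ rest) (sym (add-sub t prev)) ⟩
          (prev + (t - prev)) + rest          ≡⟨ +-assoc prev (t - prev) rest ⟩
          prev + ((t - prev) + rest)          ≡⟨ cong (λ c → prev + (c + rest)) (sym (*-identityʳ (t - prev))) ⟩
          prev + ((t - prev) * 1ℝ + rest)     ∎
      where
      open ≡-Reasoning
      rest : ℝ
      rest = sumV (map term (layers t ts)) j
      skip-prev : v j ∈ prev ∷ t ∷ ts → v j ∈ t ∷ ts
      skip-prev (here vj≡prev) = contradiction (≤-trans t≤vj (≤-reflexive vj≡prev)) t≰prev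
      skip-prev (there m) = m
    ... | no t≰vj = begin
          v j                                 ≡⟨ must-be-prev vj∈ ⟩
          prev                                ≡⟨ sym (+-identityʳ prev) ⟩
          prev + 0ℝ                           ≡⟨ cong (prev +_) (sym (+-identityʳ 0ℝ)) ⟩
          prev + (0ℝ + 0ℝ)                    ≡⟨ cong₂ (λ a b → prev + (a + b)) (sym (zeroʳ (t - prev)))
                                                       (sym (layers-vanish t ts above-vj)) ⟩
          prev + ((t - prev) * 0ℝ + sumV (map term (layers t ts)) j) ∎
      where
      open ≡-Reasoning
      t≤all : All (t ≤_) (t ∷ ts)
      t≤all = Linked⇒All ≤-trans ≤-refl sorted
      above-vj : All (λ t′ → ¬ t′ ≤ v j) ts
      above-vj = All.map (λ t≤t′ t′≤vj → t≰vj (≤-trans t≤t′ t′≤vj)) (All.tail t≤all)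
      must-be-prev : v j ∈ prev ∷ t ∷ ts → v j ≡ prev
      must-be-prev (here vj≡prev) = vj≡prev
      must-be-prev (there m) = contradiction (All.lookup t≤all m) t≰vj

    module _ (p : Preposet) (mono : Monotone p v) where

      above-lump : ∀ t → LumpLE (above t) p
      above-lump t = up-closed , down-closed
        where
        up-closed : UpClosed p (above t)
        up-closed i j i∈ j≥i = dec-true (t ≤? v j) (≤-trans (does-true (t ≤? v i) i∈) (mono j i j≥i))
        down-closed : DownClosed p (λ i → not (above t i))
        down-closed i j i∉ i≥j = cong not (dec-false (t ≤? v j) λ t≤vj →
          does-false (t ≤? v i) (not-injective i∉) (≤-trans t≤vj (mono i j i≥j)))

      layers-admissible : ∀ {i₀} prev ts → v i₀ ≤ prev → All (λ t → ∃[ i ] v i ≡ t) ts →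
                          All (Admissible p) (layers prev ts)
      layers-admissible prev [] _ [] = []
      layers-admissible {i₀} prev (t ∷ ts) vi₀≤prev ((i , vi≡t) ∷ values) with t ≤? prev
      ... | yes _ = layers-admissible prev ts vi₀≤prev values
      ... | no t≰prev =
        (two-lump , above-lump t , ≤⇒sub-nonneg prev≤t) ∷ layers-admissible t ts (≤-trans vi₀≤prev prev≤t) values
        where
        prev≤t : prev ≤ t
        prev≤t = ≰⇒≥ t≰prev
        two-lump : TwoLump (above t)
        two-lump = (i , dec-true (t ≤? v i) (≤-reflexive (sym vi≡t)))
                 , (i₀ , dec-false (t ≤? v i₀) λ t≤vi₀ → t≰prev (≤-trans t≤vi₀ vi₀≤prev))

      from-sorted-values : (L : List ℝ) → Linked _≤_ L → All (λ t → ∃[ i ] v i ≡ t) L →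
                           (∀ j → v j ∈ L) → InSigma p v
      from-sorted-values [] _ _ covers = [] , [] , (0ℝ , λ j → contradiction (covers j) λ ())
      from-sorted-values (t₀ ∷ ts) sorted ((i₀ , vi₀≡t₀) ∷ values) covers =
        layers t₀ ts , layers-admissible t₀ ts (≤-reflexive vi₀≡t₀) values ,
        (t₀ , λ j → layer-cake t₀ ts sorted (covers j))

  monotone⊆σ : ∀ {p v} → Monotone p v → InSigma p v
  monotone⊆σ {p} {v} mono =
    LayerCake.from-sorted-values v p mono (sort values) (sort-↗ values)
      (All-resp-↭ (↭-sym (sort-↭ values)) (AllP.map⁺ (All.universal (λ i → i , refl) (allFin n))))
      (λ j → ∈-resp-↭ (↭-sym (sort-↭ values)) (∈-map⁺ v (∈-allFin j)))
    where
    values : List ℝ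
    values = map v (allFin n)

mainTheorem7 : (Rf : RealField) (K : CharZeroField) (n : ℕ) (p : Braid.Preposet Rf K {n}) →
    Braid.IsCharFun Rf K (Braid.braidCone Rf K p) (Braid.InSigma Rf K p)
mainTheorem7 Rf K n p v =
    (λ v∈σ → braidCone-monotone {p} {v} (σ⊆monotone {p} v∈σ))
  , (λ v∉σ → braidCone-not-monotone {p} {v} (v∉σ ∘ monotone⊆σ {p} {v}))
  where open BraidConeProof Rf K {n}
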